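{- For every finite graph $G$, \[ \operatorname{pn}_\ell(G) \geq \max\left\{ \frac{|E(H)|}{2|V(H)|-3} \;\middle|\; H \subseteq G,\ H \neq \emptyset \right\}. \]
   Context: All graphs are finite and simple; $H \subseteq G$ ranges over nonempty subgraphs of $G$. A linear embedding of a graph $G=(V,E)$ is a pair $(\prec,\mathcal{P})$ where $\prec$ is a total order on $V$ and $\mathcal{P}$ is a partition of $E$ into parts called pages. Two edges $uv, xy$ with $u\prec v$, $x \prec y$ cross if $u \prec x \prec v \prec y$ or $x \prec u \prec y \prec v$. A linear embedding is a book embedding if no two crossing edges lie in the same page. For a book embedding and a vertex $v$, let $\mathcal{P}_v$ be the set of pages containing at least one edge incident to $v$; the embedding is $k$-local if $|\mathcal{P}_v|\le k$ for all $v$. The local page number $\operatorname{pn}_\ell(G)$ is the least $k$ such that $G$ has a $k$-local book embedding (with any number of pages). -}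

module Defs where

open import Data.Nat using (ℕ; zero; suc; _+_; _*_; _∸_; _≤_; _<_)
open import Data.Fin using (Fin; toℕ)
open import Data.Bool using (Bool; true; false; _∧_)
open import Data.List using (List; length; filter; allFin; concatMap; map)
open import Data.List.Membership.Propositional using (_∈_)
open import Data.Product using (Σ; _×_; _,_; ∃)
open import Relation.Nullary using (¬_)
open import Relation.Binary.PropositionalEquality using (_≡_)
open import Function.Definitions using (Injective)
open import Data.Nat using (_<?_)
open import Relation.Nullary.Decidable using (⌊_⌋)

record Graph : Set where
  field
    n      : ℕ
    adj    : Fin n → Fin n → Bool
    sym    : ∀ u v → adj u v ≡ adj v u
    irrefl : ∀ v → adj v v ≡ false
open Graph public

Adj : (G : Graph) → Fin (n G) → Fin (n G) → Set
Adj G u v = adj G u v ≡ true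

count : {m : ℕ} → (Fin m → Bool) → ℕ
count {m} p = length (filter (λ i → p i Data.Bool.≟ true) (allFin m))

countPairs : {m : ℕ} → (Fin m → Fin m → Bool) → ℕ
countPairs {m} r =
  length (filter (λ ij → (⌊ toℕ (Data.Product.proj₁ ij) <? toℕ (Data.Product.proj₂ ij) ⌋
                           ∧ r (Data.Product.proj₁ ij) (Data.Product.proj₂ ij)) Data.Bool.≟ true)
                 (concatMap (λ i → map (λ j → (i , j)) (allFin m)) (allFin m)))

numEdges : Graph → ℕ
numEdges G = countPairs (adj G)

record Subgraph (G : Graph) : Set where
  field
    vs     : Fin (n G) → Bool
    es     : Fin (n G) → Fin (n G) → Bool
    es-sym : ∀ u v → es u v ≡ es v u
    es-adj : ∀ u v → es u v ≡ true → adj G u v ≡ true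
    es-vs  : ∀ u v → es u v ≡ true → vs u ≡ true
open Subgraph public

|V| : {G : Graph} → Subgraph G → ℕ
|V| H = count (vs H)

|E| : {G : Graph} → Subgraph G → ℕ
|E| H = countPairs (es H)

-- A linear embedding: the total order ≺ is given by an injective position map
-- (u ≺ v iff pos u < pos v); the partition of E into pages is given by a page
-- label for every edge (any number of pages, labels in ℕ).
record LinearEmbedding (G : Graph) : Set where
  field
    pos      : Fin (n G) → Fin (n G)
    pos-inj  : Injective _≡_ _≡_ pos
    page     : Fin (n G) → Fin (n G) → ℕ
    page-sym : ∀ u v → Adj G u v → page u v ≡ page v u
open LinearEmbedding public

_≺[_]_ : {G : Graph} → Fin (n G) → LinearEmbedding G → Fin (n G) → Set
u ≺[ L ] v = toℕ (pos L u) < toℕ (pos L v)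

IsBook : {G : Graph} → LinearEmbedding G → Set
IsBook {G} L = ∀ u v x y → Adj G u v → Adj G x y →
  u ≺[ L ] x → x ≺[ L ] v → v ≺[ L ] y → ¬ (page L u v ≡ page L x y)

-- k-local: for every vertex v, the set P_v of pages containing an edge at v
-- has at most k elements (i.e. is covered by a list of length ≤ k).
IsLocal : {G : Graph} → ℕ → LinearEmbedding G → Set
IsLocal {G} k L = ∀ v → Σ (List ℕ) λ Pv → length Pv ≤ k ×
  (∀ w → Adj G v w → page L v w ∈ Pv)

HasLocalBookEmbedding : Graph → ℕ → Set
HasLocalBookEmbedding G k = Σ (LinearEmbedding G) λ L → IsBook L × IsLocal k L

IsLocalPageNumber : Graph → ℕ → Set
IsLocalPageNumber G k = HasLocalBookEmbedding G k ×
  (∀ j → HasLocalBookEmbedding G j → k ≤ j)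

-- Fix a k-local book embedding of G and a subgraph H.  For a page p let E_p be the
-- number of edges of H on p and W_p the number of vertices of H touched by them.
-- The edges on one page are pairwise non-crossing along the spine order, and a
-- non-empty non-crossing edge set touching w vertices has at most 2w − 3 edges
-- (the outerplanar bound; module Noncrossing, by induction on rank intervals).
-- Locality puts every vertex into at most k of the W_p, so Σ W_p ≤ k |V(H)|.  With
-- T the number of non-empty pages, Σ E_p ≤ 2 Σ W_p − 3T ≤ 2k|V(H)| − 3T and
-- Σ E_p ≤ T (2|V(H)| − 3); either T ≤ k or T > k then gives the bound.
module Submission where

open import Defs hiding (sym)
open import Data.Nat using (ℕ; zero; suc; _+_; _*_; _∸_; _≤_; _<_; z≤n; s≤s)
open import Data.Nat.Properties
open import Data.Fin using (Fin; toℕ; fromℕ<) renaming (zero to fzero; suc to fsuc; _≟_ to _≟ᶠ_)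
open import Data.Fin.Properties using (toℕ-injective; toℕ<n; toℕ-fromℕ<; any?) renaming (suc-injective to fsuc-injective)
open import Data.Product using (∃; _×_; _,_; proj₁; proj₂)
open import Data.Bool as Bool using (Bool; true; false; _∧_)
open import Data.List using (List; []; _∷_; length; filter; tabulate; map; concat; _++_)
open import Data.List.Properties using (filter-++; length-++; map-tabulate)
open import Data.List.Membership.Propositional using (_∈_)
open import Data.List.Membership.DecPropositional _≟_ using (_∈?_)
open import Data.List.Relation.Unary.Any using (here; there)
open import Data.Sum using (_⊎_; inj₁; inj₂)
open import Data.Empty using (⊥; ⊥-elim)
open import Relation.Nullary using (¬_; Dec; yes; no)
open import Relation.Nullary.Decidable using (⌊_⌋; _×-dec_; _⊎-dec_)
open import Function.Definitions using (Injective)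
open import Relation.Binary.PropositionalEquality
  using (_≡_; _≢_; refl; sym; trans; cong; cong₂; subst; module ≡-Reasoning)
open import Relation.Binary.Definitions using (tri<; tri≈; tri>)
open import Function using (_∘_; id)
open import Data.Nat.Tactic.RingSolver using (solve-∀)
open import Algebra.Properties.Semiring.Sum +-*-semiring
  using (sum-syntax; ∑-distrib-+; ∑-comm; *-distribˡ-sum; *-distribʳ-sum; sum-cong-≗; sum-replicate-zero)

𝟙 : ∀ {p} {P : Set p} → Dec P → ℕ
𝟙 (yes _) = 1
𝟙 (no _) = 0

𝟙-yes : ∀ {p} {P : Set p} (d : Dec P) → P → 𝟙 d ≡ 1
𝟙-yes (yes _) _ = refl
𝟙-yes (no ¬p) p = ⊥-elim (¬p p)

𝟙-no : ∀ {p} {P : Set p} (d : Dec P) → ¬ P → 𝟙 d ≡ 0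
𝟙-no (yes p) ¬p = ⊥-elim (¬p p)
𝟙-no (no _) _ = refl

𝟙-mono : ∀ {p q} {P : Set p} {Q : Set q} → (P → Q) → (dp : Dec P) (dq : Dec Q) → 𝟙 dp ≤ 𝟙 dq
𝟙-mono f (yes p) (yes q) = ≤-refl
𝟙-mono f (yes p) (no ¬q) = ⊥-elim (¬q (f p))
𝟙-mono f (no _) dq = z≤n

𝟙-union : ∀ {p q r} {P : Set p} {Q : Set q} {R : Set r} → (P → Q ⊎ R) →
  (dp : Dec P) (dq : Dec Q) (dr : Dec R) → 𝟙 dp ≤ 𝟙 dq + 𝟙 dr
𝟙-union f (no _) dq dr = z≤n
𝟙-union f (yes p) (yes _) dr = s≤s z≤n
𝟙-union f (yes p) (no ¬q) (yes _) = s≤s z≤n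
𝟙-union f (yes p) (no ¬q) (no ¬r) with f p
... | inj₁ q = ⊥-elim (¬q q)
... | inj₂ r = ⊥-elim (¬r r)

𝟙-overlap : ∀ {p q r s} {P : Set p} {Q : Set q} {R : Set r} {S : Set s} →
  (Q → P) → (R → P) → (Q → R → S) →
  (dq : Dec Q) (dr : Dec R) (dp : Dec P) (ds : Dec S) → 𝟙 dq + 𝟙 dr ≤ 𝟙 dp + 𝟙 ds
𝟙-overlap f g h (no _) (no _) dp ds = z≤n
𝟙-overlap f g h (yes q) (yes r) dp ds rewrite 𝟙-yes dp (f q) | 𝟙-yes ds (h q r) = ≤-refl
𝟙-overlap f g h (yes q) (no _) dp ds rewrite 𝟙-yes dp (f q) = s≤s z≤n
𝟙-overlap f g h (no _) (yes r) dp ds rewrite 𝟙-yes dp (g r) = s≤s z≤n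

𝟙-disjoint : ∀ {p q r} {P : Set p} {Q : Set q} {R : Set r} →
  (Q → P) → (R → P) → (Q → R → ⊥) → (dq : Dec Q) (dr : Dec R) (dp : Dec P) → 𝟙 dq + 𝟙 dr ≤ 𝟙 dp
𝟙-disjoint f g h dq dr dp = subst (𝟙 dq + 𝟙 dr ≤_) (+-identityʳ (𝟙 dp)) (𝟙-overlap f g h dq dr dp (no λ ()))

∑-mono : ∀ {n} {f g : Fin n → ℕ} → (∀ i → f i ≤ g i) → ∑[ i < n ] f i ≤ ∑[ i < n ] g i
∑-mono {zero} h = z≤n
∑-mono {suc n} h = +-mono-≤ (h fzero) (∑-mono (h ∘ fsuc))

∑-zero : ∀ {n} (f : Fin n → ℕ) → (∀ i → f i ≡ 0) → ∑[ i < n ] f i ≡ 0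
∑-zero {n} f h = trans (sum-cong-≗ h) (sum-replicate-zero n)

∑-term : ∀ {n} (f : Fin n → ℕ) i → f i ≤ ∑[ j < n ] f j
∑-term f fzero = m≤m+n (f fzero) _
∑-term f (fsuc i) = ≤-trans (∑-term (f ∘ fsuc) i) (m≤n+m _ (f fzero))

∑-two : ∀ {n} (f : Fin n → ℕ) i j → i ≢ j → f i + f j ≤ ∑[ k < n ] f k
∑-two f fzero fzero i≢j = ⊥-elim (i≢j refl)
∑-two f fzero (fsuc j) _ = +-monoʳ-≤ (f fzero) (∑-term (f ∘ fsuc) j)
∑-two f (fsuc i) fzero _ =
  subst (_≤ ∑[ k < _ ] f k) (+-comm (f fzero) (f (fsuc i))) (+-monoʳ-≤ (f fzero) (∑-term (f ∘ fsuc) i))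
∑-two f (fsuc i) (fsuc j) i≢j =
  ≤-trans (∑-two (f ∘ fsuc) i j (i≢j ∘ cong fsuc)) (m≤n+m _ (f fzero))

∑-𝟙-witness : ∀ {n p} {P : Fin n → Set p} (P? : ∀ i → Dec (P i)) i → P i → 1 ≤ ∑[ j < n ] 𝟙 (P? j)
∑-𝟙-witness P? i pi = ≤-trans (≤-reflexive (sym (𝟙-yes (P? i) pi))) (∑-term (λ j → 𝟙 (P? j)) i)

∑-𝟙-unique : ∀ {n p} {P : Fin n → Set p} (P? : ∀ i → Dec (P i)) →
  (∀ i j → P i → P j → i ≡ j) → ∑[ i < n ] 𝟙 (P? i) ≤ 1
∑-𝟙-unique {zero} P? unique = z≤n
∑-𝟙-unique {suc n} P? unique with P? fzero
... | yes p0 = ≤-reflexive (cong suc (∑-zero _ λ i → 𝟙-no (P? (fsuc i)) λ pi → 0≢suc (unique fzero (fsuc i) p0 pi)))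
  where
  0≢suc : ∀ {i : Fin n} → fzero ≢ fsuc i
  0≢suc ()
... | no _ = ∑-𝟙-unique (P? ∘ fsuc) λ i j pi pj → fsuc-injective (unique (fsuc i) (fsuc j) pi pj)

∑∑-mono : ∀ {m n} {f g : Fin m → Fin n → ℕ} → (∀ i j → f i j ≤ g i j) →
  ∑[ i < m ] ∑[ j < n ] f i j ≤ ∑[ i < m ] ∑[ j < n ] g i j
∑∑-mono h = ∑-mono λ i → ∑-mono (h i)

∑∑-distrib-+ : ∀ {m n} (f g : Fin m → Fin n → ℕ) →
  ∑[ i < m ] ∑[ j < n ] (f i j + g i j) ≡ ∑[ i < m ] ∑[ j < n ] f i j + ∑[ i < m ] ∑[ j < n ] g i j
∑∑-distrib-+ {m} {n} f g =
  trans (sum-cong-≗ λ i → ∑-distrib-+ (f i) (g i)) (∑-distrib-+ (λ i → ∑[ j < n ] f i j) (λ i → ∑[ j < n ] g i j))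

length-filter-tabulate : ∀ {a p} {A : Set a} {P : A → Set p} (P? : ∀ x → Dec (P x)) {n} (f : Fin n → A) →
  length (filter P? (tabulate f)) ≡ ∑[ i < n ] 𝟙 (P? (f i))
length-filter-tabulate P? {zero} f = refl
length-filter-tabulate P? {suc n} f with P? (f fzero)
... | yes _ = cong suc (length-filter-tabulate P? (f ∘ fsuc))
... | no _ = length-filter-tabulate P? (f ∘ fsuc)

length-filter-concat-tabulate : ∀ {a p} {A : Set a} {P : A → Set p} (P? : ∀ x → Dec (P x)) {n}
  (f : Fin n → List A) → length (filter P? (concat (tabulate f))) ≡ ∑[ i < n ] length (filter P? (f i))
length-filter-concat-tabulate P? {zero} f = refl
length-filter-concat-tabulate P? {suc n} f = begin
  length (filter P? (f fzero ++ concat (tabulate (f ∘ fsuc))))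
    ≡⟨ cong length (filter-++ P? (f fzero) _) ⟩
  length (filter P? (f fzero) ++ filter P? (concat (tabulate (f ∘ fsuc))))
    ≡⟨ length-++ (filter P? (f fzero)) ⟩
  length (filter P? (f fzero)) + length (filter P? (concat (tabulate (f ∘ fsuc))))
    ≡⟨ cong (length (filter P? (f fzero)) +_) (length-filter-concat-tabulate P? (f ∘ fsuc)) ⟩
  ∑[ i < suc n ] length (filter P? (f i)) ∎
  where open ≡-Reasoning

count-as-sum : ∀ {m} (p : Fin m → Bool) → count p ≡ ∑[ i < m ] 𝟙 (p i Bool.≟ true)
count-as-sum p = length-filter-tabulate (λ i → p i Bool.≟ true) id

countPairs-as-sum : ∀ {m} (e : Fin m → Fin m → Bool) →
  countPairs e ≡ ∑[ i < m ] ∑[ j < m ] 𝟙 ((⌊ toℕ i <? toℕ j ⌋ ∧ e i j) Bool.≟ true)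
countPairs-as-sum {m} e = begin
  length (filter P? (concat (map row (tabulate id))))
    ≡⟨ cong (length ∘ filter P? ∘ concat) (map-tabulate id row) ⟩
  length (filter P? (concat (tabulate row)))
    ≡⟨ length-filter-concat-tabulate P? row ⟩
  ∑[ i < m ] length (filter P? (map (i ,_) (tabulate id)))
    ≡⟨ sum-cong-≗ (λ i → cong (length ∘ filter P?) (map-tabulate id (i ,_))) ⟩
  ∑[ i < m ] length (filter P? (tabulate (i ,_)))
    ≡⟨ sum-cong-≗ (λ i → length-filter-tabulate P? (i ,_)) ⟩
  ∑[ i < m ] ∑[ j < m ] 𝟙 ((⌊ toℕ i <? toℕ j ⌋ ∧ e i j) Bool.≟ true) ∎
  where
  open ≡-Reasoning
  P? : (ij : Fin m × Fin m) → Dec _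
  P? (i , j) = (⌊ toℕ i <? toℕ j ⌋ ∧ e i j) Bool.≟ true
  row : Fin m → List (Fin m × Fin m)
  row i = map (i ,_) (tabulate id)

double-injective : ∀ x y → x + x ≡ y + y → x ≡ y
double-injective x y eq with <-cmp x y
... | tri< x<y _ _ = ⊥-elim (<⇒≢ (+-mono-< x<y x<y) eq)
... | tri≈ _ x≡y _ = x≡y
... | tri> _ _ y<x = ⊥-elim (<⇒≢ (+-mono-< y<x y<x) (sym eq))

-- Counting its pairs {u, v} once each, in
-- the direction of increasing rank, gives the same number for every injective ranking:
-- each such count is half the number of ordered pairs.
module Orientation {m : ℕ} (e : Fin m → Fin m → Bool) (e-sym : ∀ u v → e u v ≡ e v u)
  (e-loopless : ∀ u → ¬ (e u u ≡ true)) where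

  ascending? : (r : Fin m → ℕ) → ∀ u v → Dec (e u v ≡ true × r u < r v)
  ascending? r u v = (e u v Bool.≟ true) ×-dec (r u <? r v)

  #ascending : (Fin m → ℕ) → ℕ
  #ascending r = ∑[ u < m ] ∑[ v < m ] 𝟙 (ascending? r u v)

  ascending-pair : ∀ {r} → Injective _≡_ _≡_ r → ∀ u v →
    𝟙 (ascending? r u v) + 𝟙 (ascending? r v u) ≡ 𝟙 (e u v Bool.≟ true)
  ascending-pair {r} r-inj u v rewrite e-sym v u with e u v Bool.≟ true | r u <? r v | r v <? r u
  ... | no _    | _       | _       = refl
  ... | yes _   | yes u<v | yes v<u = ⊥-elim (<-asym u<v v<u)
  ... | yes _   | yes _   | no _    = refl
  ... | yes _   | no _    | yes _   = refl
  ... | yes euv | no u≮v  | no v≮u  =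
    ⊥-elim (e-loopless u (subst (λ w → e u w ≡ true) (sym (r-inj (≤-antisym (≮⇒≥ v≮u) (≮⇒≥ u≮v)))) euv))

  #ascending-double : ∀ {r} → Injective _≡_ _≡_ r →
    #ascending r + #ascending r ≡ ∑[ u < m ] ∑[ v < m ] 𝟙 (e u v Bool.≟ true)
  #ascending-double {r} r-inj = begin
    #ascending r + #ascending r
      ≡⟨ cong (#ascending r +_) (∑-comm (λ v u → 𝟙 (ascending? r v u))) ⟩
    #ascending r + ∑[ u < m ] ∑[ v < m ] 𝟙 (ascending? r v u)
      ≡⟨ ∑∑-distrib-+ (λ u v → 𝟙 (ascending? r u v)) (λ u v → 𝟙 (ascending? r v u)) ⟨
    ∑[ u < m ] ∑[ v < m ] (𝟙 (ascending? r u v) + 𝟙 (ascending? r v u))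
      ≡⟨ sum-cong-≗ (λ u → sum-cong-≗ (ascending-pair r-inj u)) ⟩
    ∑[ u < m ] ∑[ v < m ] 𝟙 (e u v Bool.≟ true) ∎
    where open ≡-Reasoning

  #ascending-invariant : ∀ {r s} → Injective _≡_ _≡_ r → Injective _≡_ _≡_ s → #ascending r ≡ #ascending s
  #ascending-invariant r-inj s-inj =
    double-injective _ _ (trans (#ascending-double r-inj) (sym (#ascending-double s-inj)))

  countPairs-ascending : countPairs e ≡ #ascending toℕ
  countPairs-ascending = trans (countPairs-as-sum e) (sum-cong-≗ λ u → sum-cong-≗ λ v → by-cases u v)
    where
    by-cases : ∀ u v → 𝟙 ((⌊ toℕ u <? toℕ v ⌋ ∧ e u v) Bool.≟ true) ≡ 𝟙 (ascending? toℕ u v)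
    by-cases u v with toℕ u <? toℕ v | e u v
    ... | yes _ | true  = refl
    ... | yes _ | false = refl
    ... | no _  | true  = refl
    ... | no _  | false = refl

largest-below : ∀ {p} {P : ℕ → Set p} → (∀ j → Dec (P j)) → ∀ b →
  (∃ λ c → c < b × P c × (∀ j → c < j → j < b → ¬ P j)) ⊎ (∀ j → j < b → ¬ P j)
largest-below P? zero = inj₂ (λ j ())
largest-below {P = P} P? (suc b) with P? b
... | yes pb = inj₁ (b , ≤-refl , pb , λ j b<j j<1+b _ → <⇒≱ b<j (m<1+n⇒m≤n j<1+b))
... | no ¬pb with largest-below P? b
...   | inj₁ (c , c<b , pc , above) = inj₁ (c , m<n⇒m<1+n c<b , pc , above′)
  where
  above′ : ∀ j → c < j → j < suc b → ¬ P j
  above′ j c<j j<1+b with m<1+n⇒m<n∨m≡n j<1+b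
  ... | inj₁ j<b = above j c<j j<b
  ... | inj₂ refl = ¬pb
...   | inj₂ none = inj₂ none′
  where
  none′ : ∀ j → j < suc b → ¬ P j
  none′ j j<1+b with m<1+n⇒m<n∨m≡n j<1+b
  ... | inj₁ j<b = none j j<b
  ... | inj₂ refl = ¬pb

-- Removing one vertex and at most one edge preserves E + 3 ≤ 2V.
peel-arith : ∀ {E E′ K V′ V} → E ≤ E′ + K → K ≤ 1 → E′ + 3 ≤ 2 * V′ → V′ + 1 ≤ V →
  E + 3 ≤ 2 * V
peel-arith {E} {E′} {K} {V′} {V} E≤ K≤1 IH V′< = begin
  E + 3             ≤⟨ +-monoˡ-≤ 3 (≤-trans E≤ (+-monoʳ-≤ E′ K≤1)) ⟩
  E′ + 1 + 3        ≡⟨ regroup E′ ⟩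
  (E′ + 3) + 1      ≤⟨ +-mono-≤ IH (n≤1+n 1) ⟩
  2 * V′ + 2        ≡⟨ *-distribˡ-+ 2 V′ 1 ⟨
  2 * (V′ + 1)      ≤⟨ *-monoʳ-≤ 2 V′< ⟩
  2 * V             ∎
  where
  open ≤-Reasoning
  regroup : ∀ x → x + 1 + 3 ≡ x + 3 + 1
  regroup = solve-∀

-- Gluing two intervals sharing one vertex, plus at most one further edge,
-- preserves E + 3 ≤ 2V.
split-arith : ∀ {E E₁ E₂ K V₁ V₂ V} → E ≤ E₁ + (E₂ + K) → K ≤ 1 →
  E₁ + 3 ≤ 2 * V₁ → E₂ + 3 ≤ 2 * V₂ → V₁ + V₂ ≤ V + 1 → E + 3 ≤ 2 * V
split-arith {E} {E₁} {E₂} {K} {V₁} {V₂} {V} E≤ K≤1 IH₁ IH₂ V≤ = +-cancelʳ-≤ 6 (E + 3) (2 * V) (begin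
  E + 3 + 6                         ≡⟨ +-assoc E 3 6 ⟩
  E + 9                             ≤⟨ +-monoˡ-≤ 9 E≤ ⟩
  E₁ + (E₂ + K) + 9                 ≡⟨ regroup E₁ E₂ K ⟩
  (E₁ + 3) + (E₂ + 3) + (K + 3)     ≤⟨ +-mono-≤ (+-mono-≤ IH₁ IH₂) (+-monoˡ-≤ 3 K≤1) ⟩
  2 * V₁ + 2 * V₂ + 4               ≡⟨ cong (_+ 4) (*-distribˡ-+ 2 V₁ V₂) ⟨
  2 * (V₁ + V₂) + 4                 ≤⟨ +-monoˡ-≤ 4 (*-monoʳ-≤ 2 V≤) ⟩
  2 * (V + 1) + 4                   ≡⟨ expand V ⟩
  2 * V + 6                         ∎)
  where
  open ≤-Reasoning
  regroup : ∀ x y z → x + (y + z) + 9 ≡ (x + 3) + (y + 3) + (z + 3)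
  regroup = solve-∀
  expand : ∀ x → 2 * (x + 1) + 4 ≡ 2 * x + 6
  expand = solve-∀

single-edge-arith : ∀ {E V} → E ≤ 1 → 2 ≤ V → E + 3 ≤ 2 * V
single-edge-arith E≤1 2≤V = ≤-trans (+-monoˡ-≤ 3 E≤1) (*-monoʳ-≤ 2 2≤V)

-- Vertices are ranked injectively by r, and Ed is a decidable set of
-- directed edges no two of which cross with respect to the ranking.  Counting
-- each edge once in the direction of increasing rank, a non-empty such edge set
-- touching w vertices has at most 2w − 3 edges.  The bound is proved for every
-- rank interval [a, b] by induction on its width: either rank a carries no
-- touched vertex and the interval shrinks, or it carries a vertex A, which is
-- peeled off (if A has no neighbour strictly inside the interval) or whose
-- farthest inner neighbour C splits the interval in two (no edge crosses AC).
module Noncrossing {n : ℕ} (r : Fin n → ℕ) (r-inj : Injective _≡_ _≡_ r)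
  (Ed : Fin n → Fin n → Set) (Ed? : ∀ u v → Dec (Ed u v))
  (noncrossing : ∀ u v x y → Ed u v → Ed x y → r u < r x → r x < r v → r v < r y → ⊥) where

  Touched : Fin n → Set
  Touched v = ∃ λ u → Ed v u ⊎ Ed u v

  touched? : ∀ v → Dec (Touched v)
  touched? v = any? λ u → Ed? v u ⊎-dec Ed? u v

  source-touched : ∀ {u v} → Ed u v → Touched u
  source-touched {v = v} e = v , inj₁ e

  target-touched : ∀ {u v} → Ed u v → Touched v
  target-touched {u} e = u , inj₂ e

  TouchedIn : ℕ → ℕ → Fin n → Set
  TouchedIn a b v = Touched v × a ≤ r v × r v ≤ b

  touchedIn? : ∀ a b v → Dec (TouchedIn a b v)
  touchedIn? a b v = touched? v ×-dec (a ≤? r v ×-dec r v ≤? b)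

  EdgeIn : ℕ → ℕ → Fin n → Fin n → Set
  EdgeIn a b u v = Ed u v × r u < r v × a ≤ r u × r v ≤ b

  edgeIn? : ∀ a b u v → Dec (EdgeIn a b u v)
  edgeIn? a b u v = Ed? u v ×-dec (r u <? r v ×-dec (a ≤? r u ×-dec r v ≤? b))

  #V : ℕ → ℕ → ℕ
  #V a b = ∑[ v < n ] 𝟙 (touchedIn? a b v)

  #E : ℕ → ℕ → ℕ
  #E a b = ∑[ u < n ] ∑[ v < n ] 𝟙 (edgeIn? a b u v)

  #V-mono : ∀ {a a′ b b′} → a′ ≤ a → b ≤ b′ → #V a b ≤ #V a′ b′
  #V-mono a′≤a b≤b′ = ∑-mono λ v →
    𝟙-mono (λ (t , a≤v , v≤b) → t , ≤-trans a′≤a a≤v , ≤-trans v≤b b≤b′)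
    (touchedIn? _ _ v) (touchedIn? _ _ v)

  #V-degenerate : ∀ {a b} → b ≤ a → #V a b ≤ 1
  #V-degenerate b≤a = ∑-𝟙-unique (touchedIn? _ _) λ u v (_ , a≤u , u≤b) (_ , a≤v , v≤b) →
    r-inj (trans (≤-antisym (≤-trans u≤b b≤a) a≤u) (≤-antisym a≤v (≤-trans v≤b b≤a)))

  two-touched⇒< : ∀ {a b} → 2 ≤ #V a b → a < b
  two-touched⇒< {a} {b} two with a <? b
  ... | yes a<b = a<b
  ... | no a≮b = ⊥-elim (≤⇒≯ (#V-degenerate (≮⇒≥ a≮b)) two)

  two-touched : ∀ {a b u v} → u ≢ v → TouchedIn a b u → TouchedIn a b v → 2 ≤ #V a b
  two-touched {a} {b} {u} {v} u≢v tu tv = ≤-trans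
    (≤-reflexive (sym (cong₂ _+_ (𝟙-yes (touchedIn? a b u) tu) (𝟙-yes (touchedIn? a b v) tv))))
    (∑-two (λ x → 𝟙 (touchedIn? a b x)) u v u≢v)

  edge-touches-two : ∀ {a b u v} → EdgeIn a b u v → 2 ≤ #V a b
  edge-touches-two (e , u<v , a≤u , v≤b) = two-touched (λ u≡v → <⇒≢ u<v (cong r u≡v))
    (source-touched e , a≤u , ≤-trans (<⇒≤ u<v) v≤b)
    (target-touched e , ≤-trans a≤u (<⇒≤ u<v) , v≤b)

  #E-empty : ∀ {a b} → ¬ (2 ≤ #V a b) → #E a b ≡ 0
  #E-empty {a} {b} few = ∑-zero _ λ u → ∑-zero _ λ v → 𝟙-no (edgeIn? a b u v) (few ∘ edge-touches-two)

  BoundUpTo : ℕ → Set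
  BoundUpTo d = ∀ a b → b ≤ a + d → 2 ≤ #V a b → #E a b + 3 ≤ 2 * #V a b

  narrower : ∀ {a b} d → b ≤ a + suc d → b ≤ suc a + d
  narrower {a} {b} d b≤ = subst (b ≤_) (+-suc a d) b≤

  module Untouched (a b : ℕ) (untouched : ∀ v → Touched v → r v ≢ a) where

    #V-skip : #V a b ≡ #V (suc a) b
    #V-skip = ≤-antisym
      (∑-mono λ v → 𝟙-mono (λ (t , a≤v , v≤b) → t , ≤∧≢⇒< a≤v (untouched v t ∘ sym) , v≤b)
                           (touchedIn? a b v) (touchedIn? (suc a) b v))
      (#V-mono (n≤1+n a) ≤-refl)

    #E-skip : #E a b ≤ #E (suc a) b
    #E-skip = ∑∑-mono λ u v → 𝟙-mono
      (λ (e , u<v , a≤u , v≤b) → e , u<v , ≤∧≢⇒< a≤u (untouched u (source-touched e) ∘ sym) , v≤b)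
      (edgeIn? a b u v) (edgeIn? (suc a) b u v)

    skip-bound : ∀ d → BoundUpTo d → b ≤ a + suc d → 2 ≤ #V a b → #E a b + 3 ≤ 2 * #V a b
    skip-bound d IH b≤ two rewrite #V-skip =
      ≤-trans (+-monoˡ-≤ 3 #E-skip) (IH (suc a) b (narrower d b≤) two)

  NeighbourAt : Fin n → ℕ → Set
  NeighbourAt A j = ∃ λ v → Ed A v × r v ≡ j

  neighbourAt? : ∀ A j → Dec (NeighbourAt A j)
  neighbourAt? A j = any? λ v → Ed? A v ×-dec (r v ≟ j)

  module Corner (a b : ℕ) {A : Fin n} (rA : r A ≡ a) (tA : Touched A) where

    rank-a⇒A : ∀ {u} → r u ≡ a → u ≡ A
    rank-a⇒A ru≡a = r-inj (trans ru≡a (sym rA))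

    Closing : Fin n → Fin n → Set
    Closing u v = u ≡ A × Ed u v × r v ≡ b

    closing? : ∀ u v → Dec (Closing u v)
    closing? u v = (u ≟ᶠ A) ×-dec (Ed? u v ×-dec (r v ≟ b))

    #closing : ℕ
    #closing = ∑[ u < n ] ∑[ v < n ] 𝟙 (closing? u v)

    #closing≤1 : #closing ≤ 1
    #closing≤1 = ≤-trans (∑-mono λ u → from u (u ≟ᶠ A))
                         (∑-𝟙-unique (_≟ᶠ A) λ u v u≡A v≡A → trans u≡A (sym v≡A))
      where
      from : ∀ u (u≟A : Dec (u ≡ A)) → ∑[ v < n ] 𝟙 (closing? u v) ≤ 𝟙 u≟A
      from u (yes _) = ∑-𝟙-unique (closing? u) λ v v′ (_ , _ , rv) (_ , _ , rv′) → r-inj (trans rv (sym rv′))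
      from u (no u≢A) = ≤-reflexive (∑-zero _ λ v → 𝟙-no (closing? u v) (u≢A ∘ proj₁))

    -- Second case: A has no neighbour with rank strictly between a and b.  Then
    -- passing to [1 + a, b] loses the vertex A and at most the closing edge.
    module Peel (no-inner : ∀ j → a < j → j < b → ¬ NeighbourAt A j) where

      edge-peel : ∀ {u v} → EdgeIn a b u v → EdgeIn (suc a) b u v ⊎ Closing u v
      edge-peel {u} {v} (e , u<v , a≤u , v≤b) with r u ≟ a
      ... | no ru≢a = inj₁ (e , u<v , ≤∧≢⇒< a≤u (ru≢a ∘ sym) , v≤b)
      ... | yes ru≡a with rank-a⇒A ru≡a
      ...   | refl with r v ≟ b
      ...     | yes rv≡b = inj₂ (refl , e , rv≡b)
      ...     | no rv≢b =
        ⊥-elim (no-inner (r v) (subst (_< r v) ru≡a u<v) (≤∧≢⇒< v≤b rv≢b) (v , e , refl))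

      #E-peel : #E a b ≤ #E (suc a) b + #closing
      #E-peel = ≤-trans
        (∑∑-mono λ u v → 𝟙-union edge-peel (edgeIn? a b u v) (edgeIn? (suc a) b u v) (closing? u v))
        (≤-reflexive (∑∑-distrib-+ (λ u v → 𝟙 (edgeIn? (suc a) b u v)) (λ u v → 𝟙 (closing? u v))))

      #V-peel : a < b → #V (suc a) b + 1 ≤ #V a b
      #V-peel a<b = begin
        #V (suc a) b + 1
          ≤⟨ +-monoʳ-≤ (#V (suc a) b) (∑-𝟙-witness (_≟ᶠ A) A refl) ⟩
        #V (suc a) b + ∑[ v < n ] 𝟙 (v ≟ᶠ A)
          ≡⟨ ∑-distrib-+ (λ v → 𝟙 (touchedIn? (suc a) b v)) (λ v → 𝟙 (v ≟ᶠ A)) ⟨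
        ∑[ v < n ] (𝟙 (touchedIn? (suc a) b v) + 𝟙 (v ≟ᶠ A))
          ≤⟨ ∑-mono (λ v → 𝟙-disjoint inner at-A
                  (λ (_ , 1+a≤v , _) v≡A → <-irrefl (sym rA) (subst (λ x → suc a ≤ r x) v≡A 1+a≤v))
                        (touchedIn? (suc a) b v) (v ≟ᶠ A) (touchedIn? a b v)) ⟩
        #V a b                                               ∎
        where
        open ≤-Reasoning
        inner : ∀ {v} → TouchedIn (suc a) b v → TouchedIn a b v
        inner (t , 1+a≤v , v≤b) = t , ≤-trans (n≤1+n a) 1+a≤v , v≤b
        at-A : ∀ {v} → v ≡ A → TouchedIn a b v
        at-A refl = tA , ≤-reflexive (sym rA) , subst (_≤ b) (sym rA) (<⇒≤ a<b)

      peel-bound : ∀ d → BoundUpTo d → b ≤ a + suc d → 2 ≤ #V a b → #E a b + 3 ≤ 2 * #V a b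
      peel-bound d IH b≤ two with 2 ≤? #V (suc a) b
      ... | yes two′ =
        peel-arith #E-peel #closing≤1 (IH (suc a) b (narrower d b≤) two′) (#V-peel (two-touched⇒< two))
      ... | no few = single-edge-arith
        (≤-trans (subst (λ x → #E a b ≤ x + #closing) (#E-empty few) #E-peel) #closing≤1) two

    -- No edge
    -- crosses AC, so every edge of [a, b] lies in [a, c], in [c, b], or is the
    -- closing edge, and the two subintervals share only the vertex C.
    module Split {c : ℕ} {C : Fin n} (eAC : Ed A C) (rC : r C ≡ c) (a<c : a < c) (c<b : c < b)
      (farthest : ∀ j → c < j → j < b → ¬ NeighbourAt A j) where

      edge-split : ∀ {u v} → EdgeIn a b u v → EdgeIn a c u v ⊎ (EdgeIn c b u v ⊎ Closing u v)
      edge-split {u} {v} (e , u<v , a≤u , v≤b) with r v ≤? c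
      ... | yes v≤c = inj₁ (e , u<v , a≤u , v≤c)
      ... | no v≰c with c ≤? r u
      ...   | yes c≤u = inj₂ (inj₁ (e , u<v , c≤u , v≤b))
      ...   | no c≰u with r u ≟ a
      ...     | no ru≢a = ⊥-elim (noncrossing A C u v eAC e
                  (subst (_< r u) (sym rA) (≤∧≢⇒< a≤u (ru≢a ∘ sym)))
                  (subst (r u <_) (sym rC) (≰⇒> c≰u)) (subst (_< r v) (sym rC) (≰⇒> v≰c)))
      ...     | yes ru≡a with rank-a⇒A ru≡a
      ...       | refl with r v ≟ b
      ...         | yes rv≡b = inj₂ (inj₂ (refl , e , rv≡b))
      ...         | no rv≢b = ⊥-elim (farthest (r v) (≰⇒> v≰c) (≤∧≢⇒< v≤b rv≢b) (v , e , refl))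

      #E-split : #E a b ≤ #E a c + (#E c b + #closing)
      #E-split = begin
        #E a b
          ≤⟨ ∑∑-mono (λ u v → 𝟙-union edge-split
               (edgeIn? a b u v) (edgeIn? a c u v) (edgeIn? c b u v ⊎-dec closing? u v)) ⟩
        ∑[ u < n ] ∑[ v < n ] (𝟙 (edgeIn? a c u v) + 𝟙 (edgeIn? c b u v ⊎-dec closing? u v))
          ≤⟨ ∑∑-mono (λ u v → +-monoʳ-≤ (𝟙 (edgeIn? a c u v))
               (𝟙-union id (edgeIn? c b u v ⊎-dec closing? u v) (edgeIn? c b u v) (closing? u v))) ⟩
        ∑[ u < n ] ∑[ v < n ] (𝟙 (edgeIn? a c u v) + (𝟙 (edgeIn? c b u v) + 𝟙 (closing? u v)))
          ≡⟨ ∑∑-distrib-+ (λ u v → 𝟙 (edgeIn? a c u v))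
                          (λ u v → 𝟙 (edgeIn? c b u v) + 𝟙 (closing? u v)) ⟩
        #E a c + ∑[ u < n ] ∑[ v < n ] (𝟙 (edgeIn? c b u v) + 𝟙 (closing? u v))
          ≡⟨ cong (#E a c +_) (∑∑-distrib-+ (λ u v → 𝟙 (edgeIn? c b u v)) (λ u v → 𝟙 (closing? u v))) ⟩
        #E a c + (#E c b + #closing) ∎
        where open ≤-Reasoning

      #V-split : #V a c + #V c b ≤ #V a b + 1
      #V-split = begin
        #V a c + #V c b
          ≡⟨ ∑-distrib-+ (λ v → 𝟙 (touchedIn? a c v)) (λ v → 𝟙 (touchedIn? c b v)) ⟨
        ∑[ v < n ] (𝟙 (touchedIn? a c v) + 𝟙 (touchedIn? c b v))
          ≤⟨ ∑-mono (λ v → 𝟙-overlap left-in right-in (λ (_ , _ , v≤c) (_ , c≤v , _) → ≤-antisym v≤c c≤v)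
                              (touchedIn? a c v) (touchedIn? c b v) (touchedIn? a b v) (r v ≟ c)) ⟩
        ∑[ v < n ] (𝟙 (touchedIn? a b v) + 𝟙 (r v ≟ c))
          ≡⟨ ∑-distrib-+ (λ v → 𝟙 (touchedIn? a b v)) (λ v → 𝟙 (r v ≟ c)) ⟩
        #V a b + ∑[ v < n ] 𝟙 (r v ≟ c)
          ≤⟨ +-monoʳ-≤ (#V a b) (∑-𝟙-unique (λ v → r v ≟ c) λ u v ru rv → r-inj (trans ru (sym rv))) ⟩
        #V a b + 1 ∎
        where
        open ≤-Reasoning
        left-in : ∀ {v} → TouchedIn a c v → TouchedIn a b v
        left-in (t , a≤v , v≤c) = t , a≤v , ≤-trans v≤c (<⇒≤ c<b)
        right-in : ∀ {v} → TouchedIn c b v → TouchedIn a b v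
        right-in (t , c≤v , v≤b) = t , ≤-trans (<⇒≤ a<c) c≤v , v≤b

      two-left : 2 ≤ #V a c
      two-left = two-touched (λ A≡C → <⇒≢ a<c (trans (sym rA) (trans (cong r A≡C) rC)))
        (tA , ≤-reflexive (sym rA) , subst (_≤ c) (sym rA) (<⇒≤ a<c))
        (target-touched eAC , subst (a ≤_) (sym rC) (<⇒≤ a<c) , ≤-reflexive rC)

      -- A closing edge would put C and the vertex of rank b into [c, b].
      closing-needs-two : ¬ (2 ≤ #V c b) → #closing ≡ 0
      closing-needs-two few = ∑-zero _ λ u → ∑-zero _ λ v → 𝟙-no (closing? u v) λ (_ , e , rv≡b) →
        few (two-touched (λ C≡v → <⇒≢ c<b (trans (sym rC) (trans (cong r C≡v) rv≡b)))
          (target-touched eAC , ≤-reflexive (sym rC) , subst (_≤ b) (sym rC) (<⇒≤ c<b))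
          (target-touched e , subst (c ≤_) (sym rv≡b) (<⇒≤ c<b) , ≤-reflexive rv≡b))

      split-bound : ∀ d → BoundUpTo d → b ≤ a + suc d → #E a b + 3 ≤ 2 * #V a b
      split-bound d IH b≤ = by-right-part (2 ≤? #V c b)
        where
        left-bound : #E a c + 3 ≤ 2 * #V a c
        left-bound = IH a c (m<1+n⇒m≤n (≤-trans c<b (subst (b ≤_) (+-suc a d) b≤))) two-left

        by-right-part : Dec (2 ≤ #V c b) → #E a b + 3 ≤ 2 * #V a b
        by-right-part (yes two-right) = split-arith {V₁ = #V a c} {V₂ = #V c b} #E-split #closing≤1 left-bound
          (IH c b (≤-trans (narrower d b≤) (+-monoˡ-≤ d a<c)) two-right) #V-split
        by-right-part (no few) =
          ≤-trans (+-monoˡ-≤ 3 only-left) (≤-trans left-bound (*-monoʳ-≤ 2 (#V-mono ≤-refl (<⇒≤ c<b))))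
          where
          only-left : #E a b ≤ #E a c
          only-left = subst (#E a b ≤_)
            (trans (cong₂ (λ x y → #E a c + (x + y)) (#E-empty few) (closing-needs-two few)) (+-identityʳ _))
            #E-split

  bound-up-to : ∀ d → BoundUpTo d
  bound-up-to zero a b b≤a+0 two = ⊥-elim (<⇒≱ (two-touched⇒< two) (subst (b ≤_) (+-identityʳ a) b≤a+0))
  bound-up-to (suc d) a b b≤ two with any? (λ v → touched? v ×-dec (r v ≟ a))
  ... | no none = Untouched.skip-bound a b (λ v t rv≡a → none (v , t , rv≡a)) d (bound-up-to d) b≤ two
  ... | yes (A , tA , rA) with largest-below (λ j → (a <? j) ×-dec neighbourAt? A j) b
  ...   | inj₁ (c , c<b , (a<c , C , eAC , rC) , above) =
    Corner.Split.split-bound a b rA tA eAC rC a<c c<b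
      (λ j c<j j<b nb → above j c<j j<b (<-trans a<c c<j , nb)) d (bound-up-to d) b≤
  ...   | inj₂ none =
    Corner.Peel.peel-bound a b rA tA (λ j a<j j<b nb → none j j<b (a<j , nb)) d (bound-up-to d) b≤ two

  one-page-bound : ∀ b → 1 ≤ #E 0 b → #E 0 b + 3 ≤ 2 * #V 0 b
  one-page-bound b has-edge with 2 ≤? #V 0 b
  ... | yes two = bound-up-to b 0 b ≤-refl two
  ... | no few = ⊥-elim (<⇒≢ has-edge (sym (#E-empty few)))

∑-𝟙-∈ : ∀ B (xs : List ℕ) → ∑[ i < B ] 𝟙 (toℕ i ∈? xs) ≤ length xs
∑-𝟙-∈ B [] = ≤-reflexive (∑-zero _ λ (i : Fin B) → 𝟙-no (toℕ i ∈? []) λ ())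
∑-𝟙-∈ B (x ∷ xs) = begin
  ∑[ i < B ] 𝟙 (toℕ i ∈? x ∷ xs)
    ≤⟨ ∑-mono (λ (i : Fin B) → 𝟙-union head-or-tail (toℕ i ∈? x ∷ xs) (toℕ i ≟ x) (toℕ i ∈? xs)) ⟩
  ∑[ i < B ] (𝟙 (toℕ i ≟ x) + 𝟙 (toℕ i ∈? xs))
    ≡⟨ ∑-distrib-+ (λ (i : Fin B) → 𝟙 (toℕ i ≟ x)) (λ (i : Fin B) → 𝟙 (toℕ i ∈? xs)) ⟩
  ∑[ i < B ] 𝟙 (toℕ i ≟ x) + ∑[ i < B ] 𝟙 (toℕ i ∈? xs)
    ≤⟨ +-mono-≤ (∑-𝟙-unique (λ (i : Fin B) → toℕ i ≟ x)
                  λ (i j : Fin B) i≡x j≡x → toℕ-injective (trans i≡x (sym j≡x)))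
                (∑-𝟙-∈ B xs) ⟩
  suc (length xs) ∎
  where
  open ≤-Reasoning
  head-or-tail : ∀ {y} → y ∈ x ∷ xs → y ≡ x ⊎ y ∈ xs
  head-or-tail (here y≡x) = inj₁ y≡x
  head-or-tail (there y∈xs) = inj₂ y∈xs

-- With T the number of non-empty terms,
-- ∑ F ≤ T (2N − 3) and ∑ F + 3T ≤ 2kN; the first settles T ≤ k, the second T > k.
sum-of-page-bounds : ∀ {B} (F W : Fin B → ℕ) k N →
  (∀ i → 1 ≤ F i → F i + 3 ≤ 2 * W i) → (∀ i → W i ≤ N) → ∑[ i < B ] W i ≤ k * N →
  ∑[ i < B ] F i ≤ k * (2 * N ∸ 3)
sum-of-page-bounds {B} F W k N page-bound W≤N ∑W≤kN = by-count (T ≤? k)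
  where
  T : ℕ
  T = ∑[ i < B ] 𝟙 (1 ≤? F i)

  term-by-count : ∀ i (d : Dec (1 ≤ F i)) → F i ≤ 𝟙 d * (2 * N ∸ 3)
  term-by-count i (yes nonempty) = subst (F i ≤_) (sym (+-identityʳ _))
    (≤-trans (m+n≤o⇒m≤o∸n (F i) (page-bound i nonempty)) (∸-monoˡ-≤ 3 (*-monoʳ-≤ 2 (W≤N i))))
  term-by-count i (no empty) rewrite n<1⇒n≡0 (≰⇒> empty) = z≤n

  term-by-weight : ∀ i (d : Dec (1 ≤ F i)) → F i + 3 * 𝟙 d ≤ 2 * W i
  term-by-weight i (yes nonempty) = page-bound i nonempty
  term-by-weight i (no empty) rewrite n<1⇒n≡0 (≰⇒> empty) = z≤n

  ∑F≤T[2N∸3] : ∑[ i < B ] F i ≤ T * (2 * N ∸ 3)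
  ∑F≤T[2N∸3] = ≤-trans (∑-mono λ i → term-by-count i (1 ≤? F i))
                       (≤-reflexive (sym (*-distribʳ-sum (2 * N ∸ 3) λ i → 𝟙 (1 ≤? F i))))

  ∑F+3T≤2kN : ∑[ i < B ] F i + 3 * T ≤ 2 * (k * N)
  ∑F+3T≤2kN = begin
    ∑[ i < B ] F i + 3 * T
      ≡⟨ cong (∑[ i < B ] F i +_) (*-distribˡ-sum 3 λ i → 𝟙 (1 ≤? F i)) ⟩
    ∑[ i < B ] F i + ∑[ i < B ] (3 * 𝟙 (1 ≤? F i))
      ≡⟨ ∑-distrib-+ F (λ i → 3 * 𝟙 (1 ≤? F i)) ⟨
    ∑[ i < B ] (F i + 3 * 𝟙 (1 ≤? F i))
      ≤⟨ ∑-mono (λ i → term-by-weight i (1 ≤? F i)) ⟩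
    ∑[ i < B ] (2 * W i)
      ≡⟨ *-distribˡ-sum 2 W ⟨
    2 * ∑[ i < B ] W i
      ≤⟨ *-monoʳ-≤ 2 ∑W≤kN ⟩
    2 * (k * N) ∎
    where open ≤-Reasoning

  by-count : Dec (T ≤ k) → ∑[ i < B ] F i ≤ k * (2 * N ∸ 3)
  by-count (yes T≤k) = ≤-trans ∑F≤T[2N∸3] (*-monoˡ-≤ (2 * N ∸ 3) T≤k)
  by-count (no T≰k) = subst (∑[ i < B ] F i ≤_) (sym (*-distribˡ-∸ k (2 * N) 3))
    (m+n≤o⇒m≤o∸n (∑[ i < B ] F i) (begin
      ∑[ i < B ] F i + k * 3
        ≤⟨ +-monoʳ-≤ (∑[ i < B ] F i) (subst (_≤ 3 * T) (*-comm 3 k) (*-monoʳ-≤ 3 (<⇒≤ (≰⇒> T≰k)))) ⟩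
      ∑[ i < B ] F i + 3 * T ≤⟨ ∑F+3T≤2kN ⟩
      2 * (k * N)            ≡⟨ *-assoc 2 k N ⟨
      2 * k * N              ≡⟨ cong (_* N) (*-comm 2 k) ⟩
      k * 2 * N              ≡⟨ *-assoc k 2 N ⟩
      k * (2 * N)            ∎))
    where open ≤-Reasoning

module Pages {G : Graph} (H : Subgraph G) (L : LinearEmbedding G) (book : IsBook L) where

  rank : Fin (n G) → ℕ
  rank v = toℕ (pos L v)

  rank-inj : Injective _≡_ _≡_ rank
  rank-inj eq = pos-inj L (toℕ-injective eq)

  OnPage : ℕ → Fin (n G) → Fin (n G) → Set
  OnPage p u v = es H u v ≡ true × page L u v ≡ p

  onPage? : ∀ p u v → Dec (OnPage p u v)
  onPage? p u v = (es H u v Bool.≟ true) ×-dec (page L u v ≟ p)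

  page-noncrossing : ∀ p u v x y → OnPage p u v → OnPage p x y →
    rank u < rank x → rank x < rank v → rank v < rank y → ⊥
  page-noncrossing p u v x y (e₁ , p₁) (e₂ , p₂) u<x x<v v<y =
    book u v x y (es-adj H u v e₁) (es-adj H x y e₂) u<x x<v v<y (trans p₁ (sym p₂))

  module Page (p : ℕ) = Noncrossing rank rank-inj (OnPage p) (onPage? p) (page-noncrossing p)

  -- All page labels lie below #pages, since each is at most the sum of all labels.
  #pages : ℕ
  #pages = suc (∑[ u < n G ] ∑[ v < n G ] page L u v)

  page< : ∀ u v → page L u v < #pages
  page< u v = s≤s (≤-trans (∑-term (page L u) v) (∑-term (λ u → ∑[ v < n G ] page L u v) u))

  edgesOn : Fin #pages → ℕ
  edgesOn i = Page.#E (toℕ i) 0 (n G)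

  verticesOn : Fin #pages → ℕ
  verticesOn i = Page.#V (toℕ i) 0 (n G)

  page-bound : ∀ i → 1 ≤ edgesOn i → edgesOn i + 3 ≤ 2 * verticesOn i
  page-bound i = Page.one-page-bound (toℕ i) (n G)

  edges-on-pages : |E| H ≤ ∑[ i < #pages ] edgesOn i
  edges-on-pages = begin
    |E| H                     ≡⟨ countPairs-ascending ⟩
    #ascending toℕ            ≡⟨ #ascending-invariant toℕ-injective rank-inj ⟩
    #ascending rank           ≤⟨ ∑∑-mono on-its-page ⟩
    ∑[ u < n G ] ∑[ v < n G ] ∑[ i < #pages ] 𝟙 (Page.edgeIn? (toℕ i) 0 (n G) u v)
      ≡⟨ sum-cong-≗ (λ u → ∑-comm λ v (i : Fin #pages) → 𝟙 (Page.edgeIn? (toℕ i) 0 (n G) u v)) ⟩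
    ∑[ u < n G ] ∑[ i < #pages ] ∑[ v < n G ] 𝟙 (Page.edgeIn? (toℕ i) 0 (n G) u v)
      ≡⟨ ∑-comm (λ u (i : Fin #pages) → ∑[ v < n G ] 𝟙 (Page.edgeIn? (toℕ i) 0 (n G) u v)) ⟩
    ∑[ i < #pages ] edgesOn i ∎
    where
    open ≤-Reasoning
    loopless : ∀ u → ¬ (es H u u ≡ true)
    loopless u euu with trans (sym (es-adj H u u euu)) (irrefl G u)
    ... | ()
    open Orientation (es H) (es-sym H) loopless
    on-its-page : ∀ u v → 𝟙 (ascending? rank u v) ≤ ∑[ i < #pages ] 𝟙 (Page.edgeIn? (toℕ i) 0 (n G) u v)
    on-its-page u v with ascending? rank u v
    ... | no _ = z≤n
    ... | yes (e , u<v) = ∑-𝟙-witness (λ i → Page.edgeIn? (toℕ i) 0 (n G) u v) (fromℕ< (page< u v))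
      ((e , sym (toℕ-fromℕ< (page< u v))) , u<v , z≤n , <⇒≤ (toℕ<n (pos L v)))

  touched⇒vertex : ∀ p v → Page.Touched p v → vs H v ≡ true
  touched⇒vertex p v (u , inj₁ (e , _)) = es-vs H v u e
  touched⇒vertex p v (u , inj₂ (e , _)) = es-vs H v u (trans (es-sym H v u) e)

  verticesOn≤ : ∀ i → verticesOn i ≤ |V| H
  verticesOn≤ i = subst (verticesOn i ≤_) (sym (count-as-sum (vs H)))
    (∑-mono λ v → 𝟙-mono (λ (t , _) → touched⇒vertex (toℕ i) v t)
                         (Page.touchedIn? (toℕ i) 0 (n G) v) (vs H v Bool.≟ true))

  module Local {k : ℕ} (local : IsLocal k L) where

    touched-page-listed : ∀ p v → Page.Touched p v → p ∈ proj₁ (local v)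
    touched-page-listed p v (u , inj₁ (e , refl)) = proj₂ (proj₂ (local v)) u (es-adj H v u e)
    touched-page-listed p v (u , inj₂ (e , refl)) =
      subst (_∈ proj₁ (local v)) (page-sym L v u adj-vu) (proj₂ (proj₂ (local v)) u adj-vu)
      where
      adj-vu : Adj G v u
      adj-vu = es-adj H v u (trans (es-sym H v u) e)

    pages-at-vertex : ∀ v (v∈H? : Dec (vs H v ≡ true)) →
      ∑[ i < #pages ] 𝟙 (Page.touchedIn? (toℕ i) 0 (n G) v) ≤ k * 𝟙 v∈H?
    pages-at-vertex v (yes _) = begin
      ∑[ i < #pages ] 𝟙 (Page.touchedIn? (toℕ i) 0 (n G) v)
        ≤⟨ ∑-mono (λ (i : Fin #pages) → 𝟙-mono (λ (t , _) → touched-page-listed (toℕ i) v t)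
                                (Page.touchedIn? (toℕ i) 0 (n G) v) (toℕ i ∈? proj₁ (local v))) ⟩
      ∑[ i < #pages ] 𝟙 (toℕ i ∈? proj₁ (local v))   ≤⟨ ∑-𝟙-∈ #pages (proj₁ (local v)) ⟩
      length (proj₁ (local v))                        ≤⟨ proj₁ (proj₂ (local v)) ⟩
      k                                               ≡⟨ *-identityʳ k ⟨
      k * 1                                           ∎
      where open ≤-Reasoning
    pages-at-vertex v (no v∉H) = ≤-trans
      (≤-reflexive (∑-zero _ λ (i : Fin #pages) → 𝟙-no (Page.touchedIn? (toℕ i) 0 (n G) v)
                                                         (λ (t , _) → v∉H (touched⇒vertex (toℕ i) v t))))
      z≤n

    locality-bound : ∑[ i < #pages ] verticesOn i ≤ k * |V| H
    locality-bound = begin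
      ∑[ i < #pages ] verticesOn i
        ≡⟨ ∑-comm (λ (i : Fin #pages) v → 𝟙 (Page.touchedIn? (toℕ i) 0 (n G) v)) ⟩
      ∑[ v < n G ] ∑[ i < #pages ] 𝟙 (Page.touchedIn? (toℕ i) 0 (n G) v)
        ≤⟨ ∑-mono (λ v → pages-at-vertex v (vs H v Bool.≟ true)) ⟩
      ∑[ v < n G ] (k * 𝟙 (vs H v Bool.≟ true))
        ≡⟨ *-distribˡ-sum k (λ v → 𝟙 (vs H v Bool.≟ true)) ⟨
      k * ∑[ v < n G ] 𝟙 (vs H v Bool.≟ true)
        ≡⟨ cong (k *_) (count-as-sum (vs H)) ⟨
      k * |V| H ∎
      where open ≤-Reasoning

local-embedding-density : ∀ {G k} → HasLocalBookEmbedding G k → (H : Subgraph G) →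
  |E| H ≤ k * (2 * |V| H ∸ 3)
local-embedding-density {k = k} (L , book , local) H =
  ≤-trans edges-on-pages
    (sum-of-page-bounds edgesOn verticesOn k (|V| H) page-bound verticesOn≤ (Local.locality-bound local))
  where open Pages H L book

-- The theorem: pn_ℓ(G) ≥ |E(H)| / (2|V(H)| − 3).
lemma1 : (G : Graph) (k : ℕ) → IsLocalPageNumber G k →
    (H : Subgraph G) → 2 ≤ |V| H → |E| H ≤ k * (2 * |V| H ∸ 3)
lemma1 G k (embedding , _) H _ = local-embedding-density embedding H
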